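{- Let $M=x^2+x+1\in\mathbb{F}_2[x]$, let $A\in\mathbb{F}_2[x]$ be nonzero, and define $A_0=A$ and for $k\ge0$: $a_{2k}=\mathrm{val}_x(A_{2k})$, $b_{2k}=\mathrm{val}_{x+1}(A_{2k})$, $A_{2k+1}=A_{2k}/(x^{a_{2k}}(x+1)^{b_{2k}})$, $A_{2k+2}=1+MA_{2k+1}$. Put $d_j=\deg(A_j)$. Then for every $k\ge 1$: $$d_{2k+1}\le d_{2k-1}\le \deg(A),\quad d_{2k}=d_{2k-1}+2,\quad d_{2k}=d_{2k+1}+a_{2k}+b_{2k}.$$
   Context: $\mathrm{val}_x(S)$ and $\mathrm{val}_{x+1}(S)$ denote the multiplicities of $x$ and $x+1$ as factors of a nonzero polynomial $S\in\mathbb{F}_2[x]$. -}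

module Defs where

open import Data.Bool using (Bool; true; false; _xor_; if_then_else_)
open import Data.List using (List; []; _∷_; length)
open import Data.Nat using (ℕ; zero; suc; _∸_)
open import Data.Product using (Σ; _×_)
open import Relation.Nullary using (¬_)
open import Relation.Binary.PropositionalEquality using (_≡_)

-- Polynomials over F₂ as coefficient lists, lowest degree first.
-- Trailing zero coefficients are allowed; equality is taken up to them (_≈_).
Poly : Set
Poly = List Bool

infixl 6 _⊕_
_⊕_ : Poly → Poly → Poly
[] ⊕ q = q
(a ∷ p) ⊕ [] = a ∷ p
(a ∷ p) ⊕ (b ∷ q) = (a xor b) ∷ (p ⊕ q)

infixl 7 _·_
_·_ : Poly → Poly → Poly
[] · q = []
(a ∷ p) · q = (if a then q else []) ⊕ (false ∷ (p · q))

infixr 8 _^_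
_^_ : Poly → ℕ → Poly
p ^ zero = true ∷ []
p ^ suc n = p · (p ^ n)

consN : Bool → Poly → Poly
consN false [] = []
consN a r = a ∷ r

norm : Poly → Poly
norm [] = []
norm (a ∷ p) = consN a (norm p)

infix 4 _≈_
_≈_ : Poly → Poly → Set
p ≈ q = norm p ≡ norm q

𝟘 𝟙 X X+1 M : Poly
𝟘 = []
𝟙 = true ∷ []
X = false ∷ true ∷ []
X+1 = true ∷ true ∷ []
M = true ∷ true ∷ true ∷ []

-- degree (meaningful for nonzero polynomials)
deg : Poly → ℕ
deg p = length (norm p) ∸ 1

infix 4 _∣_
_∣_ : Poly → Poly → Set
P ∣ S = Σ Poly (λ Q → S ≈ P · Q)

Val : Poly → Poly → ℕ → Set
Val P S n = (P ^ n ∣ S) × ¬ (P ^ suc n ∣ S)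

-- The cofactor B of A₂ₖ left after removing all factors x and x+1 satisfies B(0) = B(1) = 1.
-- As also M(0) = M(1) = 1, the polynomial A₂ₖ₊₂ = 1 + M·B vanishes at 0 and at 1, so a₂ₖ₊₂ ≥ 1 and
-- b₂ₖ₊₂ ≥ 1.  Since deg (1 + M·B) = deg B + 2, removing these factors loses at least the two degrees
-- just gained, whence d₂ₖ₊₁ ≤ d₂ₖ₋₁ ≤ … ≤ d₁ ≤ d₀ = deg A.
module Submission where

open import Defs
open import Data.Bool using (Bool; true; false; _xor_; _∧_; if_then_else_)
open import Data.Bool.Properties
  using (xor-assoc; xor-identityʳ; ∧-comm; ∧-distribʳ-xor; ¬-not; xor-∧-commutativeRing)
open import Data.List using ([]; _∷_; length)
open import Data.Nat using (ℕ; zero; suc; _+_; _*_; _∸_; _≤_; _<_; z≤n; s≤s)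
open import Data.Nat.Properties
  using ( module ≤-Reasoning; ≤-refl; ≤-trans; ≤-reflexive; <⇒≤; <-cmp; m≤n+m
        ; +-comm; +-assoc; *-suc; +-mono-≤; +-monoˡ-≤; +-cancelˡ-≤ )
open import Data.Product using (Σ; _×_; _,_; proj₁; proj₂)
open import Data.Empty using (⊥-elim)
open import Function using (case_of_)
open import Relation.Nullary using (¬_)
open import Relation.Binary using (tri<; tri≈; tri>)
open import Relation.Binary.PropositionalEquality
open import Algebra.Bundles using (CommutativeRing)
open import Algebra.Properties.CommutativeSemigroup
  (CommutativeRing.+-commutativeSemigroup xor-∧-commutativeRing) using (interchange; x∙yz≈y∙xz)

coeff : Poly → ℕ → Bool
coeff []      n       = false
coeff (a ∷ p) zero    = a
coeff (a ∷ p) (suc n) = coeff p n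

infix 4 _≋_
record _≋_ (p q : Poly) : Set where
  constructor mk≋
  field at : ∀ n → coeff p n ≡ coeff q n
open _≋_

≋-refl : ∀ {p} → p ≋ p
≋-refl .at n = refl

≋-sym : ∀ {p q} → p ≋ q → q ≋ p
≋-sym e .at n = sym (at e n)

≋-trans : ∀ {p q r} → p ≋ q → q ≋ r → p ≋ r
≋-trans e f .at n = trans (at e n) (at f n)

∷-cong : ∀ {a b p q} → a ≡ b → p ≋ q → a ∷ p ≋ b ∷ q
∷-cong e f .at zero    = e
∷-cong e f .at (suc n) = at f n

∷-≋[] : ∀ {a p} → a ≡ false → p ≋ [] → a ∷ p ≋ []
∷-≋[] e f .at zero    = e
∷-≋[] e f .at (suc n) = at f n

∷-≋[]⁻¹ : ∀ {a p} → a ∷ p ≋ [] → p ≋ []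
∷-≋[]⁻¹ e .at n = at e (suc n)

∷-injectiveʳ : ∀ {a b p q} → a ∷ p ≋ b ∷ q → p ≋ q
∷-injectiveʳ e .at n = at e (suc n)

coeff-⊕ : ∀ p q n → coeff (p ⊕ q) n ≡ coeff p n xor coeff q n
coeff-⊕ []      q       n       = refl
coeff-⊕ (a ∷ p) []      n       = sym (xor-identityʳ _)
coeff-⊕ (a ∷ p) (b ∷ q) zero    = refl
coeff-⊕ (a ∷ p) (b ∷ q) (suc n) = coeff-⊕ p q n

⊕-cong : ∀ {p p′ q q′} → p ≋ p′ → q ≋ q′ → p ⊕ q ≋ p′ ⊕ q′
⊕-cong {p} {p′} {q} {q′} e f .at n =
  trans (coeff-⊕ p q n) (trans (cong₂ _xor_ (at e n) (at f n)) (sym (coeff-⊕ p′ q′ n)))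

⊕-identityʳ : ∀ p → p ⊕ [] ≋ p
⊕-identityʳ p .at n = trans (coeff-⊕ p [] n) (xor-identityʳ _)

coeff-if-⊕ : ∀ a q s n → coeff ((if a then q else []) ⊕ s) n ≡ (a ∧ coeff q n) xor coeff s n
coeff-if-⊕ true  q s n = coeff-⊕ q s n
coeff-if-⊕ false q s n = refl

·-zeroʳ : ∀ p → p · [] ≋ []
·-zeroʳ []          = ≋-refl
·-zeroʳ (true ∷ p)  = ∷-≋[] refl (·-zeroʳ p)
·-zeroʳ (false ∷ p) = ∷-≋[] refl (·-zeroʳ p)

·-identityˡ : ∀ p → 𝟙 · p ≋ p
·-identityˡ p .at n =
  trans (coeff-⊕ p (false ∷ []) n) (trans (cong (coeff p n xor_) (coeff-[0] n)) (xor-identityʳ _))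
  where
  coeff-[0] : ∀ n → coeff (false ∷ []) n ≡ false
  coeff-[0] zero    = refl
  coeff-[0] (suc n) = refl

·-congʳ : ∀ p {q q′} → q ≋ q′ → p · q ≋ p · q′
·-congʳ []          e = ≋-refl
·-congʳ (true ∷ p)  e = ⊕-cong e (∷-cong refl (·-congʳ p e))
·-congʳ (false ∷ p) e = ∷-cong refl (·-congʳ p e)

·-distribʳ-⊕ : ∀ p q r → (p ⊕ q) · r ≋ p · r ⊕ q · r
·-distribʳ-⊕ []      q       r = ≋-refl
·-distribʳ-⊕ (a ∷ p) []      r = ≋-sym (⊕-identityʳ _)
·-distribʳ-⊕ (a ∷ p) (b ∷ q) r .at n = begin
    coeff (((a ∷ p) ⊕ (b ∷ q)) · r) n
  ≡⟨ coeff-if-⊕ (a xor b) r _ n ⟩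
    ((a xor b) ∧ coeff r n) xor coeff (false ∷ (p ⊕ q) · r) n
  ≡⟨ cong₂ _xor_ (∧-distribʳ-xor (coeff r n) a b)
                 (trans (at (∷-cong refl (·-distribʳ-⊕ p q r)) n)
                        (coeff-⊕ (false ∷ p · r) (false ∷ q · r) n)) ⟩
    ((a ∧ coeff r n) xor (b ∧ coeff r n)) xor (coeff (false ∷ p · r) n xor coeff (false ∷ q · r) n)
  ≡⟨ interchange (a ∧ coeff r n) (b ∧ coeff r n) (coeff (false ∷ p · r) n) (coeff (false ∷ q · r) n) ⟩
    ((a ∧ coeff r n) xor coeff (false ∷ p · r) n) xor ((b ∧ coeff r n) xor coeff (false ∷ q · r) n)
  ≡⟨ sym (cong₂ _xor_ (coeff-if-⊕ a r _ n) (coeff-if-⊕ b r _ n)) ⟩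
    coeff ((a ∷ p) · r) n xor coeff ((b ∷ q) · r) n
  ≡⟨ sym (coeff-⊕ ((a ∷ p) · r) ((b ∷ q) · r) n) ⟩
    coeff ((a ∷ p) · r ⊕ (b ∷ q) · r) n ∎
  where open ≡-Reasoning

·-∷ʳ : ∀ p b q → p · (b ∷ q) ≋ (if b then p else []) ⊕ (false ∷ p · q)
·-∷ʳ []      true  q = ≋-sym (∷-≋[] refl ≋-refl)
·-∷ʳ []      false q = ≋-sym (∷-≋[] refl ≋-refl)
·-∷ʳ (a ∷ p) b q .at zero =
  trans (coeff-if-⊕ a (b ∷ q) _ 0) (trans (cong (_xor false) (∧-comm a b)) (sym (coeff-if-⊕ b (a ∷ p) _ 0)))
·-∷ʳ (a ∷ p) b q .at (suc m) = begin
    coeff ((a ∷ p) · (b ∷ q)) (suc m)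
  ≡⟨ coeff-if-⊕ a (b ∷ q) _ (suc m) ⟩
    (a ∧ coeff q m) xor coeff (p · (b ∷ q)) m
  ≡⟨ cong ((a ∧ coeff q m) xor_) (trans (at (·-∷ʳ p b q) m) (coeff-if-⊕ b p _ m)) ⟩
    (a ∧ coeff q m) xor ((b ∧ coeff p m) xor coeff (false ∷ p · q) m)
  ≡⟨ x∙yz≈y∙xz (a ∧ coeff q m) (b ∧ coeff p m) (coeff (false ∷ p · q) m) ⟩
    (b ∧ coeff p m) xor ((a ∧ coeff q m) xor coeff (false ∷ p · q) m)
  ≡⟨ sym (cong ((b ∧ coeff p m) xor_) (coeff-if-⊕ a q _ m)) ⟩
    (b ∧ coeff p m) xor coeff ((a ∷ p) · q) m
  ≡⟨ sym (coeff-if-⊕ b (a ∷ p) _ (suc m)) ⟩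
    coeff ((if b then a ∷ p else []) ⊕ (false ∷ (a ∷ p) · q)) (suc m) ∎
  where open ≡-Reasoning

·-comm : ∀ p q → p · q ≋ q · p
·-comm []      q = ≋-sym (·-zeroʳ q)
·-comm (a ∷ p) q = ≋-trans (⊕-cong ≋-refl (∷-cong refl (·-comm p q))) (≋-sym (·-∷ʳ q a p))

·-congˡ : ∀ {p p′} q → p ≋ p′ → p · q ≋ p′ · q
·-congˡ {p} {p′} q e = ≋-trans (·-comm p q) (≋-trans (·-congʳ q e) (·-comm q p′))

·-assoc : ∀ p q r → (p · q) · r ≋ p · (q · r)
·-assoc []          q r = ≋-refl
·-assoc (true ∷ p)  q r =
  ≋-trans (·-distribʳ-⊕ q (false ∷ p · q) r) (⊕-cong ≋-refl (∷-cong refl (·-assoc p q r)))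
·-assoc (false ∷ p) q r = ∷-cong refl (·-assoc p q r)

coeff-consN : ∀ a r n → coeff (consN a r) n ≡ coeff (a ∷ r) n
coeff-consN false []      zero    = refl
coeff-consN false []      (suc n) = refl
coeff-consN false (x ∷ r) n       = refl
coeff-consN true  r       n       = refl

coeff-norm : ∀ p n → coeff (norm p) n ≡ coeff p n
coeff-norm []      n       = refl
coeff-norm (a ∷ p) zero    = coeff-consN a (norm p) zero
coeff-norm (a ∷ p) (suc n) = trans (coeff-consN a (norm p) (suc n)) (coeff-norm p n)

≈⇒≋ : ∀ {p q} → p ≈ q → p ≋ q
≈⇒≋ {p} {q} e .at n = trans (sym (coeff-norm p n)) (trans (cong (λ l → coeff l n) e) (coeff-norm q n))

≋[]⇒norm≡[] : ∀ p → p ≋ [] → norm p ≡ []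
≋[]⇒norm≡[] []      e = refl
≋[]⇒norm≡[] (a ∷ p) e with at e 0
... | refl rewrite ≋[]⇒norm≡[] p (∷-≋[]⁻¹ e) = refl

≋⇒≈ : ∀ {p q} → p ≋ q → p ≈ q
≋⇒≈ {[]}    {[]}    e = refl
≋⇒≈ {[]}    {b ∷ q} e = sym (≋[]⇒norm≡[] (b ∷ q) (≋-sym e))
≋⇒≈ {a ∷ p} {[]}    e = ≋[]⇒norm≡[] (a ∷ p) e
≋⇒≈ {a ∷ p} {b ∷ q} e with at e 0
... | refl = cong (consN a) (≋⇒≈ (∷-injectiveʳ e))

coeff₀-· : ∀ p q → coeff (p · q) 0 ≡ coeff p 0 ∧ coeff q 0
coeff₀-· []      q = refl
coeff₀-· (a ∷ p) q = trans (coeff-if-⊕ a q _ 0) (xor-identityʳ _)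

eval₁ : Poly → Bool
eval₁ []      = false
eval₁ (a ∷ p) = a xor eval₁ p

eval₁-consN : ∀ a r → eval₁ (consN a r) ≡ a xor eval₁ r
eval₁-consN false []      = refl
eval₁-consN false (x ∷ r) = refl
eval₁-consN true  r       = refl

eval₁-norm : ∀ p → eval₁ (norm p) ≡ eval₁ p
eval₁-norm []      = refl
eval₁-norm (a ∷ p) = trans (eval₁-consN a (norm p)) (cong (a xor_) (eval₁-norm p))

eval₁-≈ : ∀ {p q} → p ≈ q → eval₁ p ≡ eval₁ q
eval₁-≈ {p} {q} e = trans (sym (eval₁-norm p)) (trans (cong eval₁ e) (eval₁-norm q))

eval₁-⊕ : ∀ p q → eval₁ (p ⊕ q) ≡ eval₁ p xor eval₁ q
eval₁-⊕ []      q       = refl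
eval₁-⊕ (a ∷ p) []      = sym (xor-identityʳ _)
eval₁-⊕ (a ∷ p) (b ∷ q) =
  trans (cong ((a xor b) xor_) (eval₁-⊕ p q)) (interchange a b (eval₁ p) (eval₁ q))

eval₁-· : ∀ p q → eval₁ (p · q) ≡ eval₁ p ∧ eval₁ q
eval₁-· []          q = refl
eval₁-· (true ∷ p)  q = trans (eval₁-⊕ q (false ∷ p · q))
  (trans (cong (eval₁ q xor_) (eval₁-· p q)) (sym (∧-distribʳ-xor (eval₁ q) true (eval₁ p))))
eval₁-· (false ∷ p) q = eval₁-· p q

X·≋shift : ∀ q → X · q ≋ false ∷ q
X·≋shift q = ∷-cong refl (·-identityˡ q)

X-factor : ∀ s → coeff s 0 ≡ false → Σ Poly λ q → s ≋ X · q
X-factor []      _    = [] , ≋-sym (·-zeroʳ X)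
X-factor (a ∷ s) refl = s , ≋-sym (X·≋shift s)

coeff-X+1·-zero : ∀ q → coeff (X+1 · q) 0 ≡ coeff q 0
coeff-X+1·-zero q = trans (coeff-⊕ q _ 0) (xor-identityʳ _)

coeff-X+1·-suc : ∀ q n → coeff (X+1 · q) (suc n) ≡ coeff q (suc n) xor coeff q n
coeff-X+1·-suc q n = trans (coeff-⊕ q _ (suc n)) (cong (coeff q (suc n) xor_) (at (·-identityˡ q) n))

-- Synthetic division: the quotient of c ∷ s by x + 1.
divX+1 : Bool → Poly → Poly
divX+1 c []      = []
divX+1 c (s ∷ r) = c ∷ divX+1 (c xor s) r

divX+1-correct : ∀ c s → c xor eval₁ s ≡ false → c ∷ s ≋ X+1 · divX+1 c s
divX+1-correct c []      c≡0  =
  ≋-trans (∷-≋[] (trans (sym (xor-identityʳ c)) c≡0) ≋-refl) (≋-sym (·-zeroʳ X+1))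
divX+1-correct c (s ∷ r) root = division
  where
  q : Poly
  q = divX+1 (c xor s) r
  ih : (c xor s) ∷ r ≋ X+1 · q
  ih = divX+1-correct (c xor s) r (trans (xor-assoc c s (eval₁ r)) root)
  xor-transpose : ∀ c s q₀ → c xor s ≡ q₀ → s ≡ q₀ xor c
  xor-transpose true  true  _ refl = refl
  xor-transpose true  false _ refl = refl
  xor-transpose false true  _ refl = refl
  xor-transpose false false _ refl = refl
  division : c ∷ s ∷ r ≋ X+1 · (c ∷ q)
  division .at zero          = sym (coeff-X+1·-zero (c ∷ q))
  division .at (suc zero)    =
    trans (xor-transpose c s _ (trans (at ih 0) (coeff-X+1·-zero q))) (sym (coeff-X+1·-suc (c ∷ q) 0))
  division .at (suc (suc n)) =
    trans (at ih (suc n)) (trans (coeff-X+1·-suc q n) (sym (coeff-X+1·-suc (c ∷ q) (suc n))))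

X+1-factor : ∀ s → eval₁ s ≡ false → Σ Poly λ q → s ≋ X+1 · q
X+1-factor []      _    = [] , ≋-sym (·-zeroʳ X+1)
X+1-factor (c ∷ s) root = divX+1 c s , divX+1-correct c s root

record HasDegree (p : Poly) (d : ℕ) : Set where
  constructor hasDegree
  field
    leading  : coeff p d ≡ true
    vanishes : ∀ n → d < n → coeff p n ≡ false
open HasDegree

HasDegree-≋ : ∀ {p q d} → p ≋ q → HasDegree p d → HasDegree q d
HasDegree-≋ {d = d} e (hasDegree top zeros) =
  hasDegree (trans (sym (at e d)) top) λ n d<n → trans (sym (at e n)) (zeros n d<n)

HasDegree⇒≉0 : ∀ {p d} → HasDegree p d → ¬ p ≋ []
HasDegree⇒≉0 {d = d} (hasDegree top _) p≋0 with trans (sym top) (at p≋0 d)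
... | ()

HasDegree-unique : ∀ {p d e} → HasDegree p d → HasDegree p e → d ≡ e
HasDegree-unique {d = d} {e} deg-d deg-e with <-cmp d e
... | tri< d<e _ _ = case trans (sym (leading deg-e)) (vanishes deg-d e d<e) of λ ()
... | tri≈ _ d≡e _ = d≡e
... | tri> _ _ e<d = case trans (sym (leading deg-d)) (vanishes deg-e d e<d) of λ ()

HasDegree-∷ : ∀ {a p d} → HasDegree p d → HasDegree (a ∷ p) (suc d)
HasDegree-∷ (hasDegree top zeros) = hasDegree top λ { zero () ; (suc n) (s≤s d<n) → zeros n d<n }

HasDegree-∷⁻¹ : ∀ {a p d} → HasDegree (a ∷ p) (suc d) → HasDegree p d
HasDegree-∷⁻¹ (hasDegree top zeros) = hasDegree top λ n d<n → zeros (suc n) (s≤s d<n)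

norm≢[]⇒≉0 : ∀ {p x xs} → norm p ≡ x ∷ xs → ¬ p ≋ []
norm≢[]⇒≉0 {p} eq p≋0 = case trans (sym eq) (≋[]⇒norm≡[] p p≋0) of λ ()

HasDegree-deg : ∀ p → ¬ p ≋ [] → HasDegree p (deg p)
HasDegree-deg []      p≉0 = ⊥-elim (p≉0 ≋-refl)
HasDegree-deg (a ∷ p) p≉0 with norm p in eq | HasDegree-deg p
HasDegree-deg (true ∷ p)  _   | [] | _ = hasDegree refl λ { zero () ; (suc n) _ → at (≈⇒≋ {p} {[]} eq) n }
HasDegree-deg (false ∷ p) p≉0 | [] | _ = ⊥-elim (p≉0 (∷-≋[] refl (≈⇒≋ eq)))
HasDegree-deg (true ∷ p)  _   | x ∷ xs | deg-p = HasDegree-∷ (deg-p (norm≢[]⇒≉0 eq))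
HasDegree-deg (false ∷ p) _   | x ∷ xs | deg-p = HasDegree-∷ (deg-p (norm≢[]⇒≉0 eq))

deg-HasDegree : ∀ {p d} → HasDegree p d → deg p ≡ d
deg-HasDegree {p} deg-d = HasDegree-unique (HasDegree-deg p (HasDegree⇒≉0 deg-d)) deg-d

HasDegree-⊕ˡ : ∀ {r s d} → (∀ n → d ≤ n → coeff r n ≡ false) → HasDegree s d → HasDegree (r ⊕ s) d
HasDegree-⊕ˡ {r} {s} {d} r-low (hasDegree top zeros) = hasDegree
  (trans (coeff-⊕ r s d) (cong₂ _xor_ (r-low d ≤-refl) top))
  λ n d<n → trans (coeff-⊕ r s n) (cong₂ _xor_ (r-low n (<⇒≤ d<n)) (zeros n d<n))

HasDegree-· : ∀ {p q d e} → HasDegree p d → HasDegree q e → HasDegree (p · q) (d + e)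
HasDegree-· {[]} (hasDegree () _)
HasDegree-· {a ∷ p} {q} {zero} (hasDegree refl zeros) deg-q = HasDegree-≋ (≋-sym q+X·pq≋q) deg-q
  where
  q+X·pq≋q : q ⊕ (false ∷ p · q) ≋ q
  q+X·pq≋q = ≋-trans (⊕-cong ≋-refl (∷-≋[] refl (·-congˡ {p} {[]} q (mk≋ λ n → zeros (suc n) (s≤s z≤n)))))
                     (⊕-identityʳ q)
HasDegree-· {a ∷ p} {q} {suc d} {e} deg-p deg-q =
  HasDegree-⊕ˡ (low a) (HasDegree-∷ (HasDegree-· (HasDegree-∷⁻¹ deg-p) deg-q))
  where
  low : ∀ a n → suc d + e ≤ n → coeff (if a then q else []) n ≡ false
  low true  n le = vanishes deg-q n (≤-trans (s≤s (m≤n+m e d)) le)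
  low false n _  = refl

HasDegree-^ : ∀ {p} → HasDegree p 1 → ∀ n → HasDegree (p ^ n) n
HasDegree-^ deg-p zero    = hasDegree refl λ { zero () ; (suc n) _ → refl }
HasDegree-^ deg-p (suc n) = HasDegree-· deg-p (HasDegree-^ deg-p n)

HasDegree-X : HasDegree X 1
HasDegree-X = hasDegree refl λ { (suc (suc n)) _ → refl ; (suc zero) (s≤s ()) }

HasDegree-X+1 : HasDegree X+1 1
HasDegree-X+1 = hasDegree refl λ { (suc (suc n)) _ → refl ; (suc zero) (s≤s ()) }

HasDegree-M : HasDegree M 2
HasDegree-M = hasDegree refl
  λ { (suc (suc (suc n))) _ → refl ; (suc (suc zero)) (s≤s (s≤s ())) ; (suc zero) (s≤s ()) }

deg-≈ : ∀ {p q} → p ≈ q → deg p ≡ deg q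
deg-≈ = cong (λ l → length l ∸ 1)

·-≉0ʳ : ∀ {s p q} → ¬ s ≋ [] → s ≋ p · q → ¬ q ≋ []
·-≉0ʳ {p = p} s≉0 s≋pq q≋0 = s≉0 (≋-trans s≋pq (≋-trans (·-congʳ p q≋0) (·-zeroʳ p)))

deg-factor : ∀ {s r a b} → ¬ s ≋ [] → s ≋ X ^ a · X+1 ^ b · r → deg s ≡ a + b + deg r
deg-factor {s} {r} {a} {b} s≉0 s≋ = deg-HasDegree (HasDegree-≋ (≋-sym s≋)
  (HasDegree-· (HasDegree-· (HasDegree-^ HasDegree-X a) (HasDegree-^ HasDegree-X+1 b))
               (HasDegree-deg r (·-≉0ʳ {p = X ^ a · X+1 ^ b} s≉0 s≋))))

deg-1+M· : ∀ {r} → ¬ r ≋ [] → deg (𝟙 ⊕ M · r) ≡ 2 + deg r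
deg-1+M· {r} r≉0 =
  deg-HasDegree (HasDegree-⊕ˡ {𝟙} (λ { (suc n) _ → refl }) (HasDegree-· HasDegree-M (HasDegree-deg r r≉0)))

1+M·-roots : ∀ {r} → coeff r 0 ≡ true → eval₁ r ≡ true →
             coeff (𝟙 ⊕ M · r) 0 ≡ false × eval₁ (𝟙 ⊕ M · r) ≡ false
1+M·-roots {r} r₀≡1 r₁≡1 =
  trans (coeff-⊕ 𝟙 (M · r) 0) (cong (true xor_) (trans (coeff₀-· M r) r₀≡1)) ,
  trans (eval₁-⊕ 𝟙 (M · r)) (cong (true xor_) (trans (eval₁-· M r) r₁≡1))

Val⇒≉0 : ∀ {P s n} → Val P s n → ¬ s ≋ []
Val⇒≉0 {P} {n = n} (_ , ¬div) s≋0 = ¬div ([] , ≋⇒≈ (≋-trans s≋0 (≋-sym (·-zeroʳ (P ^ suc n)))))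

^-suc-· : ∀ p n q → p ^ n · (p · q) ≋ p ^ suc n · q
^-suc-· p n q = ≋-trans (≋-sym (·-assoc (p ^ n) p q)) (·-congˡ q (·-comm (p ^ n) p))

Val-cofactor : ∀ {P s n r q} → Val P s n → s ≋ P ^ n · r → ¬ r ≋ P · q
Val-cofactor {P} {n = n} {q = q} (_ , ¬div) s≋ r≋ =
  ¬div (q , ≋⇒≈ (≋-trans s≋ (≋-trans (·-congʳ (P ^ n) r≋) (^-suc-· P n q))))

Val-pos : ∀ {P s n q} → Val P s n → s ≋ P · q → 1 ≤ n
Val-pos {P} {s} {zero} {q} v s≋Pq = ⊥-elim (Val-cofactor {P} {s} {0} {s} {q} v (≋-sym (·-identityˡ s)) s≋Pq)
Val-pos {n = suc n} _ _ = s≤s z≤n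

Val-X-pos : ∀ {s a} → Val X s a → coeff s 0 ≡ false → 1 ≤ a
Val-X-pos {s} v s₀≡0 = Val-pos {X} {s} v (proj₂ (X-factor s s₀≡0))

Val-X+1-pos : ∀ {s b} → Val X+1 s b → eval₁ s ≡ false → 1 ≤ b
Val-X+1-pos {s} v s₁≡0 = Val-pos {X+1} {s} v (proj₂ (X+1-factor s s₁≡0))

cofactor-roots : ∀ {s r a b} → Val X s a → Val X+1 s b → s ≋ X ^ a · X+1 ^ b · r →
                 coeff r 0 ≡ true × eval₁ r ≡ true
cofactor-roots {s} {r} {a} {b} vX vX+1 s≋ =
  ∧≡true⇒ʳ (trans (sym (coeff₀-· (X+1 ^ b) r)) (¬-not Yᵇr₀≢0)) ,
  ∧≡true⇒ʳ (trans (sym (eval₁-· (X ^ a) r)) (¬-not Xᵃr₁≢0))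
  where
  ∧≡true⇒ʳ : ∀ {x y} → x ∧ y ≡ true → y ≡ true
  ∧≡true⇒ʳ {true} y≡1 = y≡1
  s≋Xᵃ· : s ≋ X ^ a · (X+1 ^ b · r)
  s≋Xᵃ· = ≋-trans s≋ (·-assoc (X ^ a) (X+1 ^ b) r)
  s≋Yᵇ· : s ≋ X+1 ^ b · (X ^ a · r)
  s≋Yᵇ· = ≋-trans s≋ (≋-trans (·-congˡ r (·-comm (X ^ a) (X+1 ^ b))) (·-assoc (X+1 ^ b) (X ^ a) r))
  Yᵇr₀≢0 : coeff (X+1 ^ b · r) 0 ≢ false
  Yᵇr₀≢0 root = Val-cofactor {X} {s} {a} vX s≋Xᵃ· (proj₂ (X-factor (X+1 ^ b · r) root))
  Xᵃr₁≢0 : eval₁ (X ^ a · r) ≢ false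
  Xᵃr₁≢0 root = Val-cofactor {X+1} {s} {b} vX+1 s≋Yᵇ· (proj₂ (X+1-factor (X ^ a · r) root))

DegreeStep : (P B C D : Poly) (a b : ℕ) → Set
DegreeStep P B C D a b = (deg D ≤ deg B × deg B ≤ deg P) × deg C ≡ deg B + 2 × deg C ≡ deg D + a + b

degree-step : ∀ {P B C D a₀ b₀ a₁ b₁} →
  Val X P a₀ → Val X+1 P b₀ → P ≈ X ^ a₀ · X+1 ^ b₀ · B →
  C ≈ 𝟙 ⊕ M · B →
  Val X C a₁ → Val X+1 C b₁ → C ≈ X ^ a₁ · X+1 ^ b₁ · D →
  DegreeStep P B C D a₁ b₁
degree-step {P} {B} {C} {D} {a₀} {b₀} {a₁} {b₁} vX-P vX+1-P P≈ C≈ vX-C vX+1-C C≈′ =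
  (deg-D≤deg-B , deg-B≤deg-P) ,
  trans deg-C≡2+B (+-comm 2 (deg B)) ,
  trans deg-C≡a+b+D (trans (+-comm (a₁ + b₁) (deg D)) (sym (+-assoc (deg D) a₁ b₁)))
  where
  P≋ : P ≋ X ^ a₀ · X+1 ^ b₀ · B
  P≋ = ≈⇒≋ P≈
  C≋ : C ≋ 𝟙 ⊕ M · B
  C≋ = ≈⇒≋ C≈
  C≋′ : C ≋ X ^ a₁ · X+1 ^ b₁ · D
  C≋′ = ≈⇒≋ C≈′
  P≉0 : ¬ P ≋ []
  P≉0 = Val⇒≉0 {X} {P} {a₀} vX-P
  deg-P≡a+b+B : deg P ≡ a₀ + b₀ + deg B
  deg-P≡a+b+B = deg-factor {P} {B} {a₀} {b₀} P≉0 P≋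
  deg-C≡a+b+D : deg C ≡ a₁ + b₁ + deg D
  deg-C≡a+b+D = deg-factor {C} {D} {a₁} {b₁} (Val⇒≉0 {X} {C} {a₁} vX-C) C≋′
  deg-C≡2+B : deg C ≡ 2 + deg B
  deg-C≡2+B = trans (deg-≈ {C} {𝟙 ⊕ M · B} C≈) (deg-1+M· (·-≉0ʳ {p = X ^ a₀ · X+1 ^ b₀} P≉0 P≋))
  C-roots : coeff C 0 ≡ false × eval₁ C ≡ false
  C-roots with cofactor-roots {P} {B} {a₀} {b₀} vX-P vX+1-P P≋
  ... | B₀ , B₁ with 1+M·-roots {B} B₀ B₁
  ... | C₀ , C₁ = trans (at C≋ 0) C₀ , trans (eval₁-≈ {C} {𝟙 ⊕ M · B} C≈) C₁
  deg-D≤deg-B : deg D ≤ deg B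
  deg-D≤deg-B = +-cancelˡ-≤ 2 (deg D) (deg B) (begin
    2 + deg D       ≤⟨ +-monoˡ-≤ (deg D) (+-mono-≤ (Val-X-pos {C} {a₁} vX-C (proj₁ C-roots))
                                                  (Val-X+1-pos {C} {b₁} vX+1-C (proj₂ C-roots))) ⟩
    a₁ + b₁ + deg D ≡⟨ sym deg-C≡a+b+D ⟩
    deg C           ≡⟨ deg-C≡2+B ⟩
    2 + deg B       ∎)
    where open ≤-Reasoning
  deg-B≤deg-P : deg B ≤ deg P
  deg-B≤deg-P = subst (deg B ≤_) (sym deg-P≡a+b+B) (m≤n+m (deg B) (a₀ + b₀))

at-2+2* : (F : ℕ → Set) → (∀ k → F (2 * k)) → ∀ j → F (2 + 2 * j)
at-2+2* F h j = subst F (*-suc 2 j) (h (suc j))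

lemma2p3 : (A : Poly) → ¬ (A ≈ 𝟘) →
    (As : ℕ → Poly) (a b : ℕ → ℕ) →
    As 0 ≈ A →
    (∀ k → Val X (As (2 * k)) (a (2 * k))) →
    (∀ k → Val X+1 (As (2 * k)) (b (2 * k))) →
    (∀ k → As (2 * k) ≈ (X ^ a (2 * k)) · (X+1 ^ b (2 * k)) · As (suc (2 * k))) →
    (∀ k → As (2 + 2 * k) ≈ 𝟙 ⊕ M · As (suc (2 * k))) →
    ∀ k → 1 ≤ k →
      (deg (As (2 * k + 1)) ≤ deg (As (2 * k ∸ 1)) × deg (As (2 * k ∸ 1)) ≤ deg A)
      × deg (As (2 * k)) ≡ deg (As (2 * k ∸ 1)) + 2
      × deg (As (2 * k)) ≡ deg (As (2 * k + 1)) + a (2 * k) + b (2 * k)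
lemma2p3 A _ As a b As₀≈A val-X val-X+1 factorisation recurrence (suc j) _ =
  subst₂ Conclusion (sym (*-suc 2 j)) (trans (cong suc (sym (*-suc 2 j))) (+-comm 1 (2 * suc j)))
    ((proj₁ (proj₁ (step j)) , odd-bound j) , proj₂ (step j))
  where
  Conclusion : ℕ → ℕ → Set
  Conclusion m n = (deg (As n) ≤ deg (As (m ∸ 1)) × deg (As (m ∸ 1)) ≤ deg A)
    × deg (As m) ≡ deg (As (m ∸ 1)) + 2
    × deg (As m) ≡ deg (As n) + a m + b m
  step : ∀ j → DegreeStep (As (2 * j)) (As (suc (2 * j))) (As (2 + 2 * j)) (As (3 + 2 * j))
                          (a (2 + 2 * j)) (b (2 + 2 * j))
  step j = degree-step {As (2 * j)} {As (suc (2 * j))} {As (2 + 2 * j)} {As (3 + 2 * j)}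
                       {a (2 * j)} {b (2 * j)} {a (2 + 2 * j)} {b (2 + 2 * j)}
    (val-X j) (val-X+1 j) (factorisation j) (recurrence j)
    (at-2+2* (λ m → Val X (As m) (a m)) val-X j)
    (at-2+2* (λ m → Val X+1 (As m) (b m)) val-X+1 j)
    (at-2+2* (λ m → As m ≈ X ^ a m · X+1 ^ b m · As (suc m)) factorisation j)
  odd-bound : ∀ j → deg (As (suc (2 * j))) ≤ deg A
  odd-bound zero    = ≤-trans (proj₂ (proj₁ (step 0))) (≤-reflexive (deg-≈ {As 0} {A} As₀≈A))
  odd-bound (suc j) = subst (λ m → deg (As (suc m)) ≤ deg A) (sym (*-suc 2 j))
    (≤-trans (proj₁ (proj₁ (step j))) (odd-bound j))
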